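{- Let $G$ be a weighted tree and let the predictions satisfy $(1-\varepsilon)d_G(v,g)\le f(v)\le(1+\varepsilon)d_G(v,g)$ for all $v$, for some unknown $\varepsilon\in(0,1/3)$. Then the algorithm described in the context, run with $\beta=2/3$, finds $g$ and incurs competitive ratio $$\frac{\mathrm{ALG}}{\mathrm{OPT}}\le 2+O\Big(n\varepsilon\,\frac{5+3\varepsilon}{(1-3\varepsilon)^2}\Big),$$ where the $O(\cdot)$ hides an absolute constant.
   Context: Exploration setting on a tree: $G=(V,E)$ is a finite undirected tree with positive edge weights, $n=|V|$, $d_G$ is the weighted shortest-path distance, $r\in V$ is the root and $g\in V$ the unknown goal (recognized upon visiting), $\mathrm{OPT}=d_G(r,g)>0$. For $S\subseteq V$, $\partial S$ is the set of vertices outside $S$ adjacent to some vertex of $S$. Having visited $V_{i-1}$, the agent knows only the subgraph $G_i$ with vertex set $V_{i-1}\cup\partial V_{i-1}$ and all edges incident to $V_{i-1}$, and predictions $f$ at those vertices. The algorithm (parameter $\beta>0$): set $v_0=r$, $V_0=\{r\}$; while $v_{i-1}\ne g$, choose $v_i\in\arg\min_{v\in\partial V_{i-1}}\big(\beta\, d_{G_i}(v_{i-1},v)+f(v)\big)$, travel to $v_i$ along a shortest path in $G_i$ (cost $d_{G_i}(v_{i-1},v_i)$), and set $V_i=\{v_0,\dots,v_i\}$. $\mathrm{ALG}$ is the total distance travelled.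
   Formalization: The edge weights, the predictions f and the parameter ε are taken to be rational. -}

module Defs where

open import Data.Nat using (ℕ; zero; suc) renaming (_≤_ to _≤ℕ_; _<_ to _<ℕ_)
open import Data.Integer using (+_)
open import Data.Rational using (ℚ; 0ℚ; 1ℚ; _+_; _*_; _-_; _≤_; _<_; _/_)
open import Data.Fin using (Fin)
open import Data.Maybe using (Maybe; just; nothing)
open import Data.List using (List; []; _∷_)
open import Data.List.Relation.Unary.Unique.Propositional using (Unique)
open import Data.Product using (Σ; ∃; _×_; _,_)
open import Data.Unit using (⊤)
open import Data.Empty using (⊥)
open import Relation.Nullary using (¬_)
open import Relation.Binary.PropositionalEquality using (_≡_; _≢_)

-- Finite undirected graphs on vertex set Fin n with positive rational
-- edge weights: w u v ≡ nothing means "no edge", just q means an edge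
-- of weight q.

record WGraph (n : ℕ) : Set where
  field
    w      : Fin n → Fin n → Maybe ℚ
    w-sym  : ∀ u v → w u v ≡ w v u
    w-loop : ∀ u → w u u ≡ nothing
    w-pos  : ∀ u v q → w u v ≡ just q → 0ℚ < q

module _ {n : ℕ} (G : WGraph n) where
  open WGraph G

  Adj : Fin n → Fin n → Set
  Adj u v = ∃ λ q → w u v ≡ just q

  data Walk (P : Fin n → Fin n → Set) : Fin n → Fin n → Set where
    stay : ∀ {u} → Walk P u u
    step : ∀ {u x v} (q : ℚ) → w u x ≡ just q → P u x → Walk P x v → Walk P u v

  weight : ∀ {P u v} → Walk P u v → ℚ
  weight stay            = 0ℚ
  weight (step q _ _ p)  = q + weight p

  len : ∀ {P u v} → Walk P u v → ℕ
  len stay            = 0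
  len (step _ _ _ p)  = suc (len p)

  verts : ∀ {P u v} → Walk P u v → List (Fin n)
  verts {u = u} stay           = u ∷ []
  verts {u = u} (step _ _ _ p) = u ∷ verts p

  AllEdges : Fin n → Fin n → Set
  AllEdges _ _ = ⊤

  Connected : Set
  Connected = ∀ u v → Walk AllEdges u v

  -- A cycle through u: an edge u–x followed by a path x ⇝ u with
  -- pairwise distinct vertices and at least 2 edges (so the cycle has
  -- at least 3 distinct vertices).
  HasCycle : Set
  HasCycle = Σ (Fin n) λ u → Σ (Fin n) λ x → Adj u x ×
             (Σ (Walk AllEdges x u) λ p → Unique (verts p) × (2 ≤ℕ len p))

  IsTree : Set
  IsTree = Connected × ¬ HasCycle

  IsShortest : (Fin n → Fin n → Set) → Fin n → Fin n → ℚ → Set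
  IsShortest P u v d = (Σ (Walk P u v) λ p → weight p ≡ d)
                     × (∀ (p : Walk P u v) → d ≤ weight p)

  IsDistG : (Fin n → Fin n → ℚ) → Set
  IsDistG d = ∀ u v → IsShortest AllEdges u v (d u v)

  Boundary : (Fin n → Set) → Fin n → Set
  Boundary S x = ¬ S x × ∃ λ y → S y × Adj y x

  -- Edges of the known subgraph G_i: those incident to S = V_{i-1}.
  Incident : (Fin n → Set) → Fin n → Fin n → Set
  Incident S a b = S a Data.Sum.⊎ S b
    where import Data.Sum

  -- Runs of the algorithm.  vs i is v_i, c i is the cost d_{G_i}(v_{i-1},v_i)
  -- of step i (i ≥ 1).  V j = {v_0,…,v_j}.

  Visited : (ℕ → Fin n) → ℕ → Fin n → Set
  Visited vs j x = ∃ λ i → i ≤ℕ j × vs i ≡ x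

  ValidStep : ℚ → (Fin n → ℚ) → (ℕ → Fin n) → (ℕ → ℚ) → ℕ → Set
  ValidStep β f vs c j =
      Boundary (Visited vs j) (vs (suc j))
    × IsShortest (Incident (Visited vs j)) (vs j) (vs (suc j)) (c (suc j))
    × (∀ u du → Boundary (Visited vs j) u
              → IsShortest (Incident (Visited vs j)) (vs j) u du
              → β * c (suc j) + f (vs (suc j)) ≤ β * du + f u)

  -- A valid run prefix v_0,…,v_k: starts at r, no earlier v_j (j < k)
  -- equals g (the loop continues while v_{j} ≠ g), and every step is valid.
  ValidPrefix : ℚ → (Fin n → ℚ) → Fin n → Fin n → ℕ → (ℕ → Fin n) → (ℕ → ℚ) → Set
  ValidPrefix β f r g k vs c =
      vs 0 ≡ r
    × (∀ j → j <ℕ k → vs j ≢ g)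
    × (∀ j → j <ℕ k → ValidStep β f vs c j)

costSum : (ℕ → ℚ) → ℕ → ℚ
costSum c zero    = 0ℚ
costSum c (suc k) = costSum c k + c (suc k)

ℕ→ℚ : ℕ → ℚ
ℕ→ℚ m = + m / 1

-- Let p_j be the head of the last edge by which the r–g path leaves V_j. In a
-- tree, p_j lies on every path from V_j ∪ ∂V_j to g, and distances from V_j to
-- ∂V_j in the known subgraph G_j are the tree distances. Since p_j ∈ ∂V_j was a
-- candidate of the greedy rule, the prediction bounds give, for each step,
--   2 c_{j+1} ≤ 3(1+ε) d(v_j,g) − 3(1−ε) d(v_{j+1},g)   and
--   (1−3ε) d(v_{j+1},g) ≤ (1+3ε) OPT,
-- so the potential 2(1−3ε) ALG_j + 3(1+ε)(1−3ε) d(v_j,g) grows by at most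
-- 6ε(1+3ε) OPT per step. A run never revisits a vertex, so it has fewer than n
-- steps, and at g the potential bounds ALG. The run cannot get stuck: while g is
-- unvisited, p_k witnesses that ∂V_k is nonempty, and a minimum over the finite
-- set ∂V_k exists.

module Submission where

open import Defs
open import Data.Bool using (T)
open import Data.Empty using (⊥-elim)
open import Data.Fin using (Fin; toℕ; _≟_)
open import Data.Fin.Properties using (pigeonhole; toℕ<n; any?)
open import Data.Integer using (+_)
import Data.Integer as ℤ
open import Data.Integer.Properties using (pos-+)
import Data.Integer.Tactic.RingSolver as ℤ-Solver
open import Data.List using ([]; _∷_; allFin; filter)
open import Data.List.Membership.Propositional using (_∈_)
open import Data.List.Membership.Propositional.Properties using (∈-allFin; ∈-filter⁺)
open import Data.List.Relation.Unary.All using (lookup)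
open import Data.List.Relation.Unary.All.Properties using (¬Any⇒All¬; all-filter)
open import Data.List.Relation.Unary.Any using (here; there)
open import Data.List.Relation.Unary.Unique.Propositional using (Unique)
open import Data.Maybe using (just; nothing)
open import Data.Nat as ℕ using (ℕ; zero; suc; z≤n; s≤s; s≤s⁻¹) renaming (_≤_ to _≤ℕ_; _<_ to _<ℕ_)
import Data.Nat.Coprimality as Coprime
import Data.Nat.Properties as ℕ
open import Data.Product using (Σ; ∃; _×_; _,_; proj₁; proj₂)
open import Data.Rational
  using (ℚ; 0ℚ; 1ℚ; _+_; _*_; _-_; -_; _≤_; _<_; _/_; _≤ᵇ_; mkℚ; toℚᵘ; nonNegative)
open import Data.Rational.Properties as ℚ using (+-*-commutativeRing)
import Data.Rational.Unnormalised as ℚᵘ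
import Data.Rational.Unnormalised.Properties as ℚᵘ
open import Data.Sum using (_⊎_; inj₁; inj₂)
open import Data.Unit using (tt)
open import Relation.Binary.Bundles using (DecTotalOrder)
open import Relation.Binary.PropositionalEquality
open import Relation.Nullary using (¬_; Dec; yes; no)
open import Relation.Nullary.Decidable using (map′; _×-dec_; ¬?)
open import Relation.Nullary.Decidable.Core using (dec⇒maybe)
open import Relation.Unary using (Decidable)
open import Tactic.RingSolver using (solve)
open import Tactic.RingSolver.Core.AlmostCommutativeRing using (AlmostCommutativeRing; fromCommutativeRing)
open import Level using (0ℓ)

open import Data.List.Extrema (DecTotalOrder.totalOrder ℚ.≤-decTotalOrder) using (argmin; argmin-all; f[argmin]≤f[xs])

private
  ℚ-ring : AlmostCommutativeRing 0ℓ 0ℓ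
  ℚ-ring = fromCommutativeRing +-*-commutativeRing (λ x → dec⇒maybe (0ℚ ℚ.≟ x))

0≤-+ : ∀ {a b} → 0ℚ ≤ a → 0ℚ ≤ b → 0ℚ ≤ a + b
0≤-+ = ℚ.+-mono-≤

0≤-* : ∀ {a b} → 0ℚ ≤ a → 0ℚ ≤ b → 0ℚ ≤ a * b
0≤-* {a} {b} 0≤a 0≤b = subst (_≤ a * b) (ℚ.*-zeroʳ a) (ℚ.*-monoˡ-≤-nonNeg a {{nonNegative 0≤a}} 0≤b)

0≤-literal : ∀ p → {T (0ℚ ≤ᵇ p)} → 0ℚ ≤ p
0≤-literal p {t} = ℚ.≤ᵇ⇒≤ t

p≤q⇒0≤q-p : ∀ {p q} → p ≤ q → 0ℚ ≤ q - p
p≤q⇒0≤q-p {p} {q} p≤q = subst (_≤ q - p) p-p≡0 (ℚ.+-monoˡ-≤ (- p) p≤q)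
  where
  p-p≡0 : p - p ≡ 0ℚ
  p-p≡0 = solve (p ∷ []) ℚ-ring

-- Every inequality below is proved by exhibiting q - p as a sum of
-- products of quantities already known to be nonnegative.
≤-byNonNegDiff : ∀ {p q} s → 0ℚ ≤ s → s ≡ q - p → p ≤ q
≤-byNonNegDiff {p} {q} s 0≤s refl =
  subst₂ _≤_ (ℚ.+-identityˡ p) q-p+p≡q (ℚ.+-monoˡ-≤ p 0≤s)
  where
  q-p+p≡q : q - p + p ≡ q
  q-p+p≡q = solve (p ∷ q ∷ []) ℚ-ring

p≤q+p : ∀ {p q} → 0ℚ ≤ q → p ≤ q + p
p≤q+p {p} {q} 0≤q = subst (_≤ q + p) (ℚ.+-identityˡ p) (ℚ.+-monoˡ-≤ p 0≤q)

p<q+p : ∀ {p q} → 0ℚ < q → p < q + p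
p<q+p {p} {q} 0<q = subst (_< q + p) (ℚ.+-identityˡ p) (ℚ.+-monoˡ-< p 0<q)

ℕ→ℚ-suc : ∀ m → ℕ→ℚ (suc m) ≡ ℕ→ℚ m + 1ℚ
ℕ→ℚ-suc m =
  ℚ.toℚᵘ-injective (ℚᵘ.≃-trans unnormalised (ℚᵘ.≃-sym (ℚ.toℚᵘ-homo-+ (ℕ→ℚ m) 1ℚ)))
  where
  ℕ→ℚ≡mkℚ : ∀ m → ℕ→ℚ m ≡ mkℚ (+ m) 0 (Coprime.sym (Coprime.1-coprimeTo m))
  ℕ→ℚ≡mkℚ m = ℚ.normalize-coprime (Coprime.sym (Coprime.1-coprimeTo m))

  cross-multiplied : ∀ x → (+ 1 ℤ.+ x) ℤ.* + 1 ≡ (x ℤ.* + 1 ℤ.+ + 1 ℤ.* + 1) ℤ.* + 1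
  cross-multiplied = ℤ-Solver.solve-∀

  unnormalised : toℚᵘ (ℕ→ℚ (suc m)) ℚᵘ.≃ (toℚᵘ (ℕ→ℚ m) ℚᵘ.+ toℚᵘ 1ℚ)
  unnormalised rewrite ℕ→ℚ≡mkℚ m | ℕ→ℚ≡mkℚ (suc m) =
    ℚᵘ.*≡* (trans (cong (ℤ._* + 1) (pos-+ 1 m)) (cross-multiplied (+ m)))

ℕ→ℚ-nonNeg : ∀ m → 0ℚ ≤ ℕ→ℚ m
ℕ→ℚ-nonNeg zero    = ℚ.≤-refl
ℕ→ℚ-nonNeg (suc m) = subst (0ℚ ≤_) (sym (ℕ→ℚ-suc m)) (0≤-+ (ℕ→ℚ-nonNeg m) (0≤-literal 1ℚ))

ℕ→ℚ-mono-≤ : ∀ {m k} → m ≤ℕ k → ℕ→ℚ m ≤ ℕ→ℚ k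
ℕ→ℚ-mono-≤ {k = k} z≤n = ℕ→ℚ-nonNeg k
ℕ→ℚ-mono-≤ (s≤s {m} {k} m≤k) =
  subst₂ _≤_ (sym (ℕ→ℚ-suc m)) (sym (ℕ→ℚ-suc k)) (ℚ.+-monoˡ-≤ 1ℚ (ℕ→ℚ-mono-≤ m≤k))

≤-telescope : ∀ (a : ℕ → ℚ) {b δ} k → a 0 ≤ b → (∀ j → j <ℕ k → a (suc j) ≤ a j + δ) →
              a k ≤ b + ℕ→ℚ k * δ
≤-telescope a {b} {δ} zero a₀≤b _ = subst (a 0 ≤_) b≡b+0δ a₀≤b
  where
  b≡b+0δ : b ≡ b + 0ℚ * δ
  b≡b+0δ = solve (b ∷ δ ∷ []) ℚ-ring
≤-telescope a {b} {δ} (suc k) a₀≤b increment = begin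
  a (suc k)              ≤⟨ increment k ℕ.≤-refl ⟩
  a k + δ                ≤⟨ ℚ.+-monoˡ-≤ δ (≤-telescope a k a₀≤b λ j j<k → increment j (ℕ.m<n⇒m<1+n j<k)) ⟩
  b + ℕ→ℚ k * δ + δ      ≡⟨ regroup (ℕ→ℚ k) ⟩
  b + (ℕ→ℚ k + 1ℚ) * δ   ≡⟨ cong (λ K → b + K * δ) (sym (ℕ→ℚ-suc k)) ⟩
  b + ℕ→ℚ (suc k) * δ    ∎
  where
  open ℚ.≤-Reasoning
  regroup : ∀ K → b + K * δ + δ ≡ b + (K + 1ℚ) * δ
  regroup K = solve (b ∷ K ∷ δ ∷ []) ℚ-ring

_[_≔_] : {A : Set} → (ℕ → A) → ℕ → A → ℕ → A
(h [ m ≔ a ]) i with i ℕ.≟ m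
... | yes _ = a
... | no  _ = h i

[≔]-≢ : ∀ {A : Set} (h : ℕ → A) {m a i} → i ≢ m → (h [ m ≔ a ]) i ≡ h i
[≔]-≢ h {m} {i = i} i≢m with i ℕ.≟ m
... | yes i≡m = ⊥-elim (i≢m i≡m)
... | no  _   = refl

[≔]-≡ : ∀ {A : Set} (h : ℕ → A) {m a} → (h [ m ≔ a ]) m ≡ a
[≔]-≡ h {m} with m ℕ.≟ m
... | yes _   = refl
... | no  m≢m = ⊥-elim (m≢m refl)

minimiser : ∀ {n} (B : Fin n → Set) → Decidable B → (score : Fin n → ℚ) → ∃ B →
            Σ (Fin n) λ u → B u × (∀ y → B y → score u ≤ score y)
minimiser {n} B B? score (b , Bb) =
  argmin score b candidates ,
  argmin-all score Bb (all-filter B? (allFin n)) ,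
  λ y By → lookup (f[argmin]≤f[xs] b candidates) (∈-filter⁺ B? (∈-allFin y) By)
  where candidates = filter B? (allFin n)

-- The ring solver treats defined constants as atoms, so the certificates below
-- restate μ, potential and δ through let.
module PredictionArithmetic (ε : ℚ) (0≤ε : 0ℚ ≤ ε) (ε≤⅓ : ε ≤ + 1 / 3) where

  μ : ℚ
  μ = 1ℚ - + 3 / 1 * ε

  0≤μ : 0ℚ ≤ μ
  0≤μ = ≤-byNonNegDiff _ (0≤-* (0≤-literal (+ 3 / 1)) (p≤q⇒0≤q-p ε≤⅓)) certificate
    where
    certificate : + 3 / 1 * (+ 1 / 3 - ε) ≡ (1ℚ - + 3 / 1 * ε) - 0ℚ
    certificate = solve (ε ∷ []) ℚ-ring

  0≤1+ε : 0ℚ ≤ 1ℚ + ε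
  0≤1+ε = 0≤-+ (0≤-literal 1ℚ) 0≤ε

  0≤1+3ε : 0ℚ ≤ 1ℚ + + 3 / 1 * ε
  0≤1+3ε = 0≤-+ (0≤-literal 1ℚ) (0≤-* (0≤-literal (+ 3 / 1)) 0≤ε)

  -- The greedy rule with β = 2/3 prefers x (cost c, distance D' to the goal)
  -- to p (cost a, distance b to the goal).
  greedy-comparison : ∀ {a b c D' fx fp} →
    (1ℚ - ε) * D' ≤ fx → fp ≤ (1ℚ + ε) * b → + 2 / 3 * c + fx ≤ + 2 / 3 * a + fp →
    + 3 / 1 * (1ℚ - ε) * D' + + 2 / 1 * c ≤ + 2 / 1 * a + + 3 / 1 * (1ℚ + ε) * b
  greedy-comparison {a} {b} {c} {D'} {fx} {fp} fx-lower fp-upper greedy =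
    ≤-byNonNegDiff _
      (0≤-+ (0≤-* k (p≤q⇒0≤q-p fx-lower))
        (0≤-+ (0≤-* k (p≤q⇒0≤q-p fp-upper)) (0≤-* k (p≤q⇒0≤q-p greedy))))
      certificate
    where
    k = 0≤-literal (+ 3 / 1)
    certificate :
      + 3 / 1 * (fx - (1ℚ - ε) * D') + (+ 3 / 1 * ((1ℚ + ε) * b - fp)
        + + 3 / 1 * ((+ 2 / 3 * a + fp) - (+ 2 / 3 * c + fx)))
      ≡ (+ 2 / 1 * a + + 3 / 1 * (1ℚ + ε) * b) - (+ 3 / 1 * (1ℚ - ε) * D' + + 2 / 1 * c)
    certificate = solve (a ∷ b ∷ c ∷ D' ∷ fx ∷ fp ∷ ε ∷ []) ℚ-ring

  step-cost-bound : ∀ {a b c D D'} →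
    + 3 / 1 * (1ℚ - ε) * D' + + 2 / 1 * c ≤ + 2 / 1 * a + + 3 / 1 * (1ℚ + ε) * b →
    a + b ≤ D → 0ℚ ≤ a →
    + 2 / 1 * c ≤ + 3 / 1 * (1ℚ + ε) * D - + 3 / 1 * (1ℚ - ε) * D'
  step-cost-bound {a} {b} {c} {D} {D'} comparison through-p 0≤a =
    ≤-byNonNegDiff _
      (0≤-+ (p≤q⇒0≤q-p comparison)
        (0≤-+ (0≤-* (0≤-* (0≤-literal (+ 3 / 1)) 0≤1+ε) (p≤q⇒0≤q-p through-p)) (0≤-* 0≤1+3ε 0≤a)))
      certificate
    where
    certificate :
      ((+ 2 / 1 * a + + 3 / 1 * (1ℚ + ε) * b) - (+ 3 / 1 * (1ℚ - ε) * D' + + 2 / 1 * c))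
        + (+ 3 / 1 * (1ℚ + ε) * (D - (a + b)) + (1ℚ + + 3 / 1 * ε) * a)
      ≡ (+ 3 / 1 * (1ℚ + ε) * D - + 3 / 1 * (1ℚ - ε) * D') - + 2 / 1 * c
    certificate = solve (a ∷ b ∷ c ∷ D ∷ D' ∷ ε ∷ []) ℚ-ring

  step-distance-bound : ∀ {a b c e D' Opt} →
    + 3 / 1 * (1ℚ - ε) * D' + + 2 / 1 * c ≤ + 2 / 1 * a + + 3 / 1 * (1ℚ + ε) * b →
    a ≤ c + e → e + b ≤ D' → b ≤ Opt →
    μ * D' ≤ (1ℚ + + 3 / 1 * ε) * Opt
  step-distance-bound {a} {b} {c} {e} {D'} {Opt} comparison detour through-p b≤Opt =
    ≤-byNonNegDiff _
      (0≤-+ (p≤q⇒0≤q-p comparison)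
        (0≤-+ (0≤-* k (p≤q⇒0≤q-p detour))
          (0≤-+ (0≤-* k (p≤q⇒0≤q-p through-p)) (0≤-* 0≤1+3ε (p≤q⇒0≤q-p b≤Opt)))))
      certificate
    where
    k = 0≤-literal (+ 2 / 1)
    certificate :
      let μ = 1ℚ - + 3 / 1 * ε in
      ((+ 2 / 1 * a + + 3 / 1 * (1ℚ + ε) * b) - (+ 3 / 1 * (1ℚ - ε) * D' + + 2 / 1 * c))
        + (+ 2 / 1 * ((c + e) - a) + (+ 2 / 1 * (D' - (e + b)) + (1ℚ + + 3 / 1 * ε) * (Opt - b)))
      ≡ (1ℚ + + 3 / 1 * ε) * Opt - μ * D'
    certificate = solve (a ∷ b ∷ c ∷ e ∷ D' ∷ Opt ∷ ε ∷ []) ℚ-ring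

  -- S is the distance travelled so far, D the current distance to the goal.
  potential : ℚ → ℚ → ℚ
  potential S D = + 2 / 1 * μ * S + + 3 / 1 * (1ℚ + ε) * μ * D

  δ : ℚ → ℚ
  δ Opt = + 6 / 1 * ε * (1ℚ + + 3 / 1 * ε) * Opt

  potential-step : ∀ {S c D D' Opt} →
    + 2 / 1 * c ≤ + 3 / 1 * (1ℚ + ε) * D - + 3 / 1 * (1ℚ - ε) * D' →
    μ * D' ≤ (1ℚ + + 3 / 1 * ε) * Opt →
    potential (S + c) D' ≤ potential S D + δ Opt
  potential-step {S} {c} {D} {D'} {Opt} cost-bound distance-bound =
    ≤-byNonNegDiff _
      (0≤-+ (0≤-* 0≤μ (p≤q⇒0≤q-p cost-bound))
        (0≤-* (0≤-* (0≤-literal (+ 6 / 1)) 0≤ε) (p≤q⇒0≤q-p distance-bound)))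
      certificate
    where
    certificate :
      let μ = 1ℚ - + 3 / 1 * ε
          Φ = λ S D → + 2 / 1 * μ * S + + 3 / 1 * (1ℚ + ε) * μ * D
          δ = λ Opt → + 6 / 1 * ε * (1ℚ + + 3 / 1 * ε) * Opt
      in
      μ * ((+ 3 / 1 * (1ℚ + ε) * D - + 3 / 1 * (1ℚ - ε) * D') - + 2 / 1 * c)
        + + 6 / 1 * ε * ((1ℚ + + 3 / 1 * ε) * Opt - μ * D')
      ≡ (Φ S D + δ Opt) - Φ (S + c) D'
    certificate = solve (S ∷ c ∷ D ∷ D' ∷ Opt ∷ ε ∷ []) ℚ-ring

  -- (1-3ε)/2 times the potential bound, plus three visibly nonnegative
  -- slack terms, is exactly the claimed competitive bound with constant 1.
  competitive-bound : ∀ {S Opt K N} → 0ℚ ≤ Opt → 0ℚ ≤ K → K ≤ N →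
    potential S 0ℚ ≤ potential 0ℚ Opt + K * δ Opt →
    S * (μ * μ) ≤ (+ 2 / 1 * (μ * μ) + 1ℚ * (N * ε * (+ 5 / 1 + + 3 / 1 * ε))) * Opt
  competitive-bound {S} {Opt} {K} {N} 0≤Opt 0≤K K≤N potential-bound =
    ≤-byNonNegDiff _
      (0≤-+ (0≤-* (0≤-* 0≤μ ½) (p≤q⇒0≤q-p potential-bound))
        (0≤-+ (0≤-* (0≤-* (0≤-* (0≤-* ½ 0≤μ) 0≤μ) 0≤μ) 0≤Opt)
          (0≤-+ (0≤-* (0≤-* (0≤-* (p≤q⇒0≤q-p K≤N) 0≤ε) 0≤5+3ε) 0≤Opt)
            (0≤-* (0≤-* (0≤-* 0≤K 0≤ε) 0≤2+3ε+27ε²) 0≤Opt))))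
      certificate
    where
    ½ = 0≤-literal (+ 1 / 2)
    0≤5+3ε = 0≤-+ (0≤-literal (+ 5 / 1)) (0≤-* (0≤-literal (+ 3 / 1)) 0≤ε)
    0≤2+3ε+27ε² = 0≤-+ (0≤-literal (+ 2 / 1))
      (0≤-+ (0≤-* (0≤-literal (+ 3 / 1)) 0≤ε) (0≤-* (0≤-* (0≤-literal (+ 27 / 1)) 0≤ε) 0≤ε))
    certificate :
      let μ = 1ℚ - + 3 / 1 * ε
          Φ = λ S D → + 2 / 1 * μ * S + + 3 / 1 * (1ℚ + ε) * μ * D
          δ = λ Opt → + 6 / 1 * ε * (1ℚ + + 3 / 1 * ε) * Opt
      in
      (μ * (+ 1 / 2)) * ((Φ 0ℚ Opt + K * δ Opt) - Φ S 0ℚ)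
        + (+ 1 / 2 * μ * μ * μ * Opt
        + ((N - K) * ε * (+ 5 / 1 + + 3 / 1 * ε) * Opt
        + K * ε * (+ 2 / 1 + (+ 3 / 1 * ε + + 27 / 1 * ε * ε)) * Opt))
      ≡ (+ 2 / 1 * (μ * μ) + 1ℚ * (N * ε * (+ 5 / 1 + + 3 / 1 * ε))) * Opt - S * (μ * μ)
    certificate = solve (S ∷ Opt ∷ K ∷ N ∷ ε ∷ []) ℚ-ring

module Walks {n : ℕ} (G : WGraph n) where
  open WGraph G

  infixr 5 _++ʷ_
  _++ʷ_ : ∀ {P u x v} → Walk G P u x → Walk G P x v → Walk G P u v
  stay           ++ʷ q = q
  step a e p rest ++ʷ q = step a e p (rest ++ʷ q)

  weight-++ʷ : ∀ {P u x v} (p : Walk G P u x) (q : Walk G P x v) →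
               weight G (p ++ʷ q) ≡ weight G p + weight G q
  weight-++ʷ stay              q = sym (ℚ.+-identityˡ _)
  weight-++ʷ (step a _ _ rest) q = trans (cong (λ t → a + t) (weight-++ʷ rest q)) (sym (ℚ.+-assoc a _ _))

  module _ {P Q : Fin n → Fin n → Set} (P⇒Q : ∀ {a b} → P a b → Q a b) where

    mapʷ : ∀ {u v} → Walk G P u v → Walk G Q u v
    mapʷ stay              = stay
    mapʷ (step a e p rest) = step a e (P⇒Q p) (mapʷ rest)

    weight-mapʷ : ∀ {u v} (p : Walk G P u v) → weight G (mapʷ p) ≡ weight G p
    weight-mapʷ stay              = refl
    weight-mapʷ (step a _ _ rest) = cong (λ t → a + t) (weight-mapʷ rest)

    verts-mapʷ : ∀ {u v} (p : Walk G P u v) → verts G (mapʷ p) ≡ verts G p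
    verts-mapʷ stay              = refl
    verts-mapʷ (step _ _ _ rest) = cong (_ ∷_) (verts-mapʷ rest)

    len-mapʷ : ∀ {u v} (p : Walk G P u v) → len G (mapʷ p) ≡ len G p
    len-mapʷ stay              = refl
    len-mapʷ (step _ _ _ rest) = cong suc (len-mapʷ rest)

  reverseʷ : ∀ {P : Fin n → Fin n → Set} {u v} → (∀ {a b} → P a b → P b a) → Walk G P u v → Walk G P v u
  reverseʷ sym-P stay                             = stay
  reverseʷ sym-P (step {u = u} {x = x} a e p rest) = reverseʷ sym-P rest ++ʷ step a (trans (w-sym x u) e) (sym-P p) stay

  weight-nonNeg : ∀ {P u v} (p : Walk G P u v) → 0ℚ ≤ weight G p
  weight-nonNeg stay              = ℚ.≤-refl
  weight-nonNeg (step a e _ rest) = 0≤-+ (ℚ.<⇒≤ (w-pos _ _ a e)) (weight-nonNeg rest)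

  shortest-unique : ∀ {P u v c c'} → IsShortest G P u v c → IsShortest G P u v c' → c ≡ c'
  shortest-unique {c = c} {c'} ((p , p≡c) , c-minimal) ((p' , p'≡c') , c'-minimal) =
    ℚ.≤-antisym (subst (c ≤_) p'≡c' (c-minimal p')) (subst (c' ≤_) p≡c (c'-minimal p))

  adjacent? : ∀ u v → Dec (Adj G u v)
  adjacent? u v with w u v
  ... | just q  = yes (q , refl)
  ... | nothing = no λ { (_ , ()) }

  head∈verts : ∀ {P u v} (p : Walk G P u v) → u ∈ verts G p
  head∈verts stay           = here refl
  head∈verts (step _ _ _ _) = here refl

module Distance {n : ℕ} (G : WGraph n) {d : Fin n → Fin n → ℚ} (isDist : IsDistG G d) where
  open WGraph G
  open Walks G

  d-witness : ∀ u v → Σ (Walk G (AllEdges G) u v) λ p → weight G p ≡ d u v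
  d-witness u v = proj₁ (isDist u v)

  d≤weight : ∀ {P u v} (p : Walk G P u v) → d u v ≤ weight G p
  d≤weight {u = u} {v} p = subst (d u v ≤_) (weight-mapʷ _ p) (proj₂ (isDist _ _) (mapʷ _ p))

  d≤isShortest : ∀ {P u v c} → IsShortest G P u v c → d u v ≤ c
  d≤isShortest {u = u} {v} ((p , weight≡c) , _) = subst (d u v ≤_) weight≡c (d≤weight p)

  d-nonNeg : ∀ u v → 0ℚ ≤ d u v
  d-nonNeg u v = subst (0ℚ ≤_) (proj₂ (d-witness u v)) (weight-nonNeg (proj₁ (d-witness u v)))

  d-refl : ∀ u → d u u ≡ 0ℚ
  d-refl u = ℚ.≤-antisym (d≤weight {P = AllEdges G} stay) (d-nonNeg u u)

  d-triangle : ∀ u x v → d u v ≤ d u x + d x v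
  d-triangle u x v with d-witness u x | d-witness x v
  ... | p , p≡ | q , q≡ = subst (d u v ≤_) (trans (weight-++ʷ p q) (cong₂ _+_ p≡ q≡)) (d≤weight (p ++ʷ q))

  d≤edge : ∀ {u v a} → w u v ≡ just a → d u v ≤ a
  d≤edge {u} {v} {a} e = subst (d u v ≤_) (ℚ.+-identityʳ a) (d≤weight {P = AllEdges G} (step a e tt stay))

  d-through : ∀ {P u v b} (p : Walk G P u v) → b ∈ verts G p → d u b + d b v ≤ weight G p
  d-through {u = u} stay (here refl) =
    ℚ.≤-reflexive (trans (cong₂ _+_ (d-refl u) (d-refl u)) (ℚ.+-identityˡ 0ℚ))
  d-through {u = u} {v} p@(step _ _ _ _) (here refl) =
    subst (_≤ weight G p) (sym (trans (cong (_+ d u v) (d-refl u)) (ℚ.+-identityˡ _))) (d≤weight p)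
  d-through {u = u} {v} {b} (step {x = x} a e _ rest) (there b∈rest) = begin
    d u b + d b v           ≤⟨ ℚ.+-monoˡ-≤ (d b v) (d-triangle u x b) ⟩
    d u x + d x b + d b v   ≤⟨ ℚ.+-monoˡ-≤ (d b v) (ℚ.+-monoˡ-≤ (d x b) (d≤edge e)) ⟩
    a + d x b + d b v       ≡⟨ ℚ.+-assoc a (d x b) (d b v) ⟩
    a + (d x b + d b v)     ≤⟨ ℚ.+-monoʳ-≤ a (d-through rest b∈rest) ⟩
    a + weight G rest       ∎
    where open ℚ.≤-Reasoning

module Tree {n : ℕ} (G : WGraph n) (tree : IsTree G) where
  open import Data.List.Relation.Unary.AllPairs using ([]; _∷_)
  import Data.List.Relation.Unary.All as All
  open import Data.List.Membership.DecPropositional (_≟_ {n}) using (_∈?_)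
  open WGraph G
  open Walks G

  suffix-from : ∀ {P x v u} (p : Walk G P x v) → u ∈ verts G p →
                Σ (Walk G P u v) λ s → Unique (verts G p) → Unique (verts G s)
  suffix-from stay              (here refl) = stay , λ unique → unique
  suffix-from p@(step _ _ _ _)  (here refl) = p , λ unique → unique
  suffix-from (step _ _ _ rest) (there u∈rest) with suffix-from rest u∈rest
  ... | s , unique-s = s , λ { (_ ∷ unique) → unique-s unique }

  simplify : ∀ {P u v} (p : Walk G P u v) → Σ (Walk G P u v) λ s → Unique (verts G s)
  simplify stay = stay , (All.[] ∷ [])
  simplify {u = u} (step a e p rest) with simplify rest
  ... | s , unique with u ∈? verts G s
  ...   | yes u∈s = proj₁ (suffix-from s u∈s) , proj₂ (suffix-from s u∈s) unique
  ...   | no  u∉s = step a e p s , (¬Any⇒All¬ _ u∉s ∷ unique)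

  Avoiding : Fin n → Fin n → Fin n → Fin n → Set
  Avoiding a b a' b' = ¬ (a' ≡ a × b' ≡ b) × ¬ (a' ≡ b × b' ≡ a)

  avoiding-sym : ∀ {a b a' b'} → Avoiding a b a' b' → Avoiding a b b' a'
  avoiding-sym (not-ab , not-ba) = (λ { (x , y) → not-ba (y , x) }) , (λ { (x , y) → not-ab (y , x) })

  -- A walk a ⇝ b avoiding the edge a–b simplifies to a path of length ≥ 2,
  -- which closes a cycle with that edge.
  edge-unavoidable : ∀ {a b q} → w a b ≡ just q → ¬ Walk G (Avoiding a b) a b
  edge-unavoidable {a} {b} {q} e p with simplify p
  ... | stay , _ with () ← trans (sym e) (w-loop a)
  edge-unavoidable e p | step _ _ (not-ab , _) stay , _ = not-ab (refl , refl)
  edge-unavoidable {a} {b} {q} e p | s@(step _ _ _ (step _ _ _ _)) , unique =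
    proj₂ tree (b , a , (q , trans (w-sym b a) e) , mapʷ _ s ,
      subst Unique (sym (verts-mapʷ _ s)) unique ,
      subst (2 ≤ℕ_) (sym (len-mapʷ _ s)) (s≤s (s≤s z≤n)))

  passes-through : ∀ {a b q P z z'} → w a b ≡ just q →
                   Walk G (Avoiding a b) a z → Walk G (Avoiding a b) b z' →
                   (p : Walk G P z z') → b ∈ verts G p
  passes-through e a⇝z b⇝z' stay = ⊥-elim (edge-unavoidable e (a⇝z ++ʷ reverseʷ avoiding-sym b⇝z'))
  passes-through {b = b} e a⇝z b⇝z' (step {u = z} {x = x} c ec pc rest) with z ≟ b | x ≟ b
  ... | yes z≡b | _       = here (sym z≡b)
  ... | no _    | yes x≡b = there (subst (_∈ verts G rest) x≡b (head∈verts rest))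
  ... | no z≢b  | no x≢b  = there (passes-through e (a⇝z ++ʷ step c ec avoids stay) b⇝z' rest)
    where avoids = (λ { (_ , x≡b) → x≢b x≡b }) , (λ { (z≡b , _) → z≢b z≡b })

Within : {n : ℕ} → (Fin n → Set) → Fin n → Fin n → Set
Within S a b = S a × S b

Outside : {n : ℕ} → (Fin n → Set) → Fin n → Fin n → Set
Outside S a b = ¬ S a × ¬ S b

module Region {n : ℕ} (G : WGraph n) {d : Fin n → Fin n → ℚ} (isDist : IsDistG G d) (tree : IsTree G)
  (S : Fin n → Set) (S? : Decidable S) (r : Fin n) (r∈S : S r)
  (reach : ∀ x → S x → Walk G (Within S) r x) where
  open WGraph G
  open Walks G
  open Distance G isDist
  open Tree G tree

  within : ∀ x y → S x → S y → Walk G (Within S) x y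
  within x y x∈S y∈S = reverseʷ (λ { (a∈S , b∈S) → b∈S , a∈S }) (reach x x∈S) ++ʷ reach y y∈S

  within-avoids : ∀ {a b} → ¬ S a ⊎ ¬ S b → ∀ {a' b'} → Within S a' b' → Avoiding a b a' b'
  within-avoids (inj₁ a∉S) (a'∈S , b'∈S) =
    (λ (a'≡a , _) → a∉S (subst S a'≡a a'∈S)) , (λ (_ , b'≡a) → a∉S (subst S b'≡a b'∈S))
  within-avoids (inj₂ b∉S) (a'∈S , b'∈S) =
    (λ (_ , b'≡b) → b∉S (subst S b'≡b b'∈S)) , (λ (a'≡b , _) → b∉S (subst S a'≡b a'∈S))

  record FirstExit {P v u} (p : Walk G P v u) : Set where
    constructor firstExitAt
    field
      y q          : Fin n
      y∈S          : S y
      q∉S          : ¬ S q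
      prefix       : Walk G (Incident G S) v y
      wq           : ℚ
      edge         : w y q ≡ just wq
      suffix       : Walk G P q u
      weight-split : weight G p ≡ weight G prefix + (wq + weight G suffix)

  firstExit : ∀ {P v u} → S v → ¬ S u → (p : Walk G P v u) → FirstExit p
  firstExit v∈S u∉S stay = ⊥-elim (u∉S v∈S)
  firstExit {v = v} v∈S u∉S (step {x = x} a e _ rest) with S? x
  ... | no x∉S = firstExitAt v x v∈S x∉S stay a e rest (sym (ℚ.+-identityˡ _))
  ... | yes x∈S with firstExit x∈S u∉S rest
  ...   | firstExitAt y q y∈S q∉S prefix wq edge suffix split =
          firstExitAt y q y∈S q∉S (step a e (inj₁ v∈S) prefix) wq edge suffix
            (trans (cong (λ t → a + t) split) (sym (ℚ.+-assoc a _ _)))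

  record ExitToward (t : Fin n) : Set where
    constructor exitAt
    field
      y p     : Fin n
      y∈S     : S y
      p∉S     : ¬ S p
      wp      : ℚ
      edge    : w y p ≡ just wp
      outside : Walk G (Outside S) p t

  private
    lastExit : ∀ {P z t} → ¬ S t → Walk G P z t → (¬ S z × Walk G (Outside S) z t) ⊎ ExitToward t
    lastExit t∉S stay = inj₁ (t∉S , stay)
    lastExit {z = z} t∉S (step {x = x} a e _ rest) with lastExit t∉S rest
    ... | inj₂ exit = inj₂ exit
    ... | inj₁ (x∉S , out) with S? z
    ...   | yes z∈S = inj₂ (exitAt z x z∈S x∉S a e out)
    ...   | no  z∉S = inj₁ (z∉S , step a e (z∉S , x∉S) out)

  exitToward : ∀ t → ¬ S t → ExitToward t
  exitToward t t∉S with lastExit t∉S (proj₁ tree r t)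
  ... | inj₁ (r∉S , _) = ⊥-elim (r∉S r∈S)
  ... | inj₂ exit      = exit

  module _ {t : Fin n} (exit : ExitToward t) where
    open ExitToward exit

    exit-boundary : Boundary G S p
    exit-boundary = p∉S , y , y∈S , wp , edge

    private
      side-of-y : ∀ x → S x ⊎ Boundary G S x → x ≢ p → Walk G (Avoiding y p) y x
      side-of-y x (inj₁ x∈S) _ = mapʷ (within-avoids (inj₂ p∉S)) (within y x y∈S x∈S)
      side-of-y x (inj₂ (_ , z , z∈S , c , z–x)) x≢p =
        side-of-y z (inj₁ z∈S) z≢p ++ʷ step c z–x avoids stay
        where
        z≢p : z ≢ p
        z≢p z≡p = p∉S (subst S z≡p z∈S)
        avoids : Avoiding y p z x
        avoids = (λ { (_ , x≡p) → x≢p x≡p }) , (λ { (z≡p , _) → z≢p z≡p })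

      side-of-p : Walk G (Avoiding y p) p t
      side-of-p = mapʷ (λ { (a∉S , b∉S) → (λ { (a≡y , _) → a∉S (subst S (sym a≡y) y∈S) })
                                          , (λ { (_ , b≡y) → b∉S (subst S (sym b≡y) y∈S) }) }) outside

    exit-separates : ∀ x → S x ⊎ Boundary G S x → d x p + d p t ≤ d x t
    exit-separates x x∈S∪∂S with x ≟ p
    ... | yes refl = ℚ.≤-reflexive (trans (cong (_+ d x t) (d-refl x)) (ℚ.+-identityˡ _))
    ... | no x≢p   = subst (d x p + d p t ≤_) (proj₂ (d-witness x t))
                       (d-through shortest (passes-through edge (side-of-y x x∈S∪∂S x≢p) side-of-p shortest))
      where shortest = proj₁ (d-witness x t)

  boundary? : Decidable (Boundary G S)
  boundary? x = ¬? (S? x) ×-dec any? (λ y → S? y ×-dec adjacent? y x)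

  isShortest-incident : ∀ v u → S v → Boundary G S u → IsShortest G (Incident G S) v u (d v u)
  isShortest-incident v u v∈S (u∉S , z , z∈S , c , z–u) =
    incident-witness (firstExit v∈S u∉S shortest) , d≤weight
    where
    shortest = proj₁ (d-witness v u)
    weight≡d = proj₂ (d-witness v u)

    incident-witness : FirstExit shortest → Σ (Walk G (Incident G S) v u) λ p → weight G p ≡ d v u
    incident-witness (firstExitAt y q y∈S q∉S prefix wq edge suffix split) with q ≟ u
    ... | yes refl = incident , ℚ.≤-antisym incident≤d (d≤weight incident)
      where
      incident = prefix ++ʷ step wq edge (inj₁ y∈S) stay
      incident≤d : weight G incident ≤ d v u
      incident≤d = subst₂ _≤_ (sym (weight-++ʷ prefix _)) (trans (sym split) weight≡d)
                     (ℚ.+-monoʳ-≤ (weight G prefix) (ℚ.+-monoʳ-≤ wq (weight-nonNeg suffix)))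
    ... | no q≢u = ⊥-elim (ℚ.<-irrefl refl d<d)
      where
      -- u hangs off S on y's side of the edge y–q, so the suffix returns through y.
      y⇝u : Walk G (Avoiding q y) y u
      y⇝u = mapʷ (within-avoids (inj₁ q∉S)) (within y z y∈S z∈S) ++ʷ step c z–u avoids-z–u stay
        where
        avoids-z–u : Avoiding q y z u
        avoids-z–u = (λ { (z≡q , _) → q∉S (subst S z≡q z∈S) }) , (λ { (_ , u≡q) → q≢u (sym u≡q) })

      d<d : d v u < d v u
      d<d = begin-strict
        d v u                           ≤⟨ d-triangle v y u ⟩
        d v y + d y u                   ≤⟨ ℚ.+-mono-≤ (d≤weight prefix) (p≤q+p (d-nonNeg q y)) ⟩
        weight G prefix + (d q y + d y u) ≤⟨ ℚ.+-monoʳ-≤ (weight G prefix) (d-through suffix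
                                              (passes-through (trans (w-sym q y) edge) stay y⇝u suffix)) ⟩
        weight G prefix + weight G suffix <⟨ ℚ.+-monoʳ-< (weight G prefix) (p<q+p (w-pos y q wq edge)) ⟩
        weight G prefix + (wq + weight G suffix) ≡⟨ trans (sym split) weight≡d ⟩
        d v u                           ∎
        where open ℚ.≤-Reasoning

module Runs {n : ℕ} (G : WGraph n) {d : Fin n → Fin n → ℚ} (isDist : IsDistG G d) (tree : IsTree G)
            (β : ℚ) (f : Fin n → ℚ) (r g : Fin n) where
  open Walks G
  open Distance G isDist

  -- ValidStep β f vs c j unfolds to GreedyStep (Visited G vs j) (vs j) (vs (suc j)) (c (suc j)).
  GreedyStep : (Fin n → Set) → Fin n → Fin n → ℚ → Set
  GreedyStep S v x c =
      Boundary G S x × IsShortest G (Incident G S) v x c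
    × (∀ u du → Boundary G S u → IsShortest G (Incident G S) v u du → β * c + f x ≤ β * du + f u)

  GreedyStep-resp : ∀ {S S' v v' x x' c c'} → (∀ y → S y → S' y) → (∀ y → S' y → S y) →
                    v ≡ v' → x ≡ x' → c ≡ c' → GreedyStep S v x c → GreedyStep S' v' x' c'
  GreedyStep-resp {S} {S'} S⊆S' S'⊆S refl refl refl (x∈∂S , x-shortest , greedy) =
    boundary-resp S⊆S' S'⊆S x∈∂S , shortest-resp S⊆S' S'⊆S x-shortest ,
    λ u du u∈∂S u-shortest →
      greedy u du (boundary-resp S'⊆S S⊆S' u∈∂S) (shortest-resp S'⊆S S⊆S' u-shortest)
    where
    incident-resp : ∀ {T T'} → (∀ y → T y → T' y) → ∀ {a b} → Incident G T a b → Incident G T' a b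
    incident-resp T⊆T' (inj₁ a∈T) = inj₁ (T⊆T' _ a∈T)
    incident-resp T⊆T' (inj₂ b∈T) = inj₂ (T⊆T' _ b∈T)

    boundary-resp : ∀ {T T'} → (∀ y → T y → T' y) → (∀ y → T' y → T y) →
                    ∀ {x} → Boundary G T x → Boundary G T' x
    boundary-resp T⊆T' T'⊆T (x∉T , y , y∈T , y–x) =
      (λ x∈T' → x∉T (T'⊆T _ x∈T')) , y , T⊆T' y y∈T , y–x

    shortest-resp : ∀ {T T'} → (∀ y → T y → T' y) → (∀ y → T' y → T y) → ∀ {v x c} →
                    IsShortest G (Incident G T) v x c → IsShortest G (Incident G T') v x c
    shortest-resp T⊆T' T'⊆T {c = c} ((p , weight≡c) , minimal) =
      (mapʷ (incident-resp T⊆T') p , trans (weight-mapʷ _ p) weight≡c) ,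
      λ p' → subst (c ≤_) (weight-mapʷ _ p') (minimal (mapʷ (incident-resp T'⊆T) p'))

  visited? : ∀ vs j → Decidable (Visited G vs j)
  visited? vs j x = map′ (λ (i , i<1+j , vsᵢ≡x) → i , s≤s⁻¹ i<1+j , vsᵢ≡x)
                         (λ (i , i≤j , vsᵢ≡x) → i , s≤s i≤j , vsᵢ≡x)
                         (ℕ.anyUpTo? (λ i → vs i ≟ x) (suc j))

  Visited-agree : ∀ {vs vs'} j → (∀ i → i ≤ℕ j → vs' i ≡ vs i) →
                  ∀ y → Visited G vs j y → Visited G vs' j y
  Visited-agree j agree y (i , i≤j , vsᵢ≡y) = i , i≤j , trans (agree i i≤j) vsᵢ≡y

  ValidStep-agree : ∀ {vs vs' c c'} j → (∀ i → i ≤ℕ suc j → vs' i ≡ vs i) → c' (suc j) ≡ c (suc j) →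
                    ValidStep G β f vs c j → ValidStep G β f vs' c' j
  ValidStep-agree j agree c-agree =
    GreedyStep-resp (Visited-agree j agree-j) (Visited-agree j (λ i i≤j → sym (agree-j i i≤j)))
      (sym (agree-j j ℕ.≤-refl)) (sym (agree (suc j) ℕ.≤-refl)) (sym c-agree)
    where agree-j = λ i i≤j → agree i (ℕ.m≤n⇒m≤1+n i≤j)

  module Prefix {k vs c} (run : ValidPrefix G β f r g k vs c) where
    V : ℕ → Fin n → Set
    V = Visited G vs

    r∈V : ∀ j → V j r
    r∈V j = 0 , z≤n , proj₁ run

    g∉V : ∀ j → j <ℕ k → ¬ V j g
    g∉V j j<k (i , i≤j , vsᵢ≡g) = proj₁ (proj₂ run) i (ℕ.≤-<-trans i≤j j<k) vsᵢ≡g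

    private
      grow₁ : ∀ {j y} → V j y → V (suc j) y
      grow₁ (i , i≤j , vsᵢ≡y) = i , ℕ.m≤n⇒m≤1+n i≤j , vsᵢ≡y

      grow : ∀ {j a b} → Within (V j) a b → Within (V (suc j)) a b
      grow (a∈V , b∈V) = grow₁ a∈V , grow₁ b∈V

    V-reach : ∀ j → j ≤ℕ k → ∀ x → V j x → Walk G (Within (V j)) r x
    V-reach zero    _       x (zero , z≤n , vs₀≡x) = subst (Walk G _ r) (trans (sym (proj₁ run)) vs₀≡x) stay
    V-reach (suc j) 1+j≤k x (i , i≤1+j , vsᵢ≡x) with ℕ.m≤n⇒m<n∨m≡n i≤1+j
    ... | inj₁ i<1+j = mapʷ grow (V-reach j j≤k x (i , s≤s⁻¹ i<1+j , vsᵢ≡x))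
      where j≤k = ℕ.≤-trans (ℕ.n≤1+n j) 1+j≤k
    ... | inj₂ refl with proj₂ (proj₂ run) j 1+j≤k
    ...   | (_ , y , y∈V , wy , y–x) , _ =
            subst (Walk G _ r) vsᵢ≡x (mapʷ grow (V-reach j (ℕ.≤-trans (ℕ.n≤1+n j) 1+j≤k) y y∈V)
              ++ʷ step wy y–x (grow₁ y∈V , (suc j , ℕ.≤-refl , refl)) stay)

    -- Each v_{j+1} lies outside V_j, so a run never revisits a vertex.
    injective : ∀ i j → i <ℕ j → j ≤ℕ k → vs i ≢ vs j
    injective i (suc j) i<1+j 1+j≤k vsᵢ≡vsⱼ =
      proj₁ (proj₁ (proj₂ (proj₂ run) j 1+j≤k)) (i , s≤s⁻¹ i<1+j , vsᵢ≡vsⱼ)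

    length<n : k <ℕ n
    length<n with suc k ℕ.≤? n
    ... | yes 1+k≤n = 1+k≤n
    ... | no  1+k≰n with pigeonhole (ℕ.≰⇒> 1+k≰n) (λ i → vs (toℕ i))
    ...   | i , j , i<j , vsᵢ≡vsⱼ = ⊥-elim (injective (toℕ i) (toℕ j) i<j (s≤s⁻¹ (toℕ<n j)) vsᵢ≡vsⱼ)

    module _ (vsₖ≢g : vs k ≢ g) where
      private
        g∉Vₖ : ¬ V k g
        g∉Vₖ (i , i≤k , vsᵢ≡g) with ℕ.m≤n⇒m<n∨m≡n i≤k
        ... | inj₁ i<k = g∉V i i<k (i , ℕ.≤-refl , vsᵢ≡g)
        ... | inj₂ refl = vsₖ≢g vsᵢ≡g

        open Region G isDist tree (V k) (visited? vs k) r (r∈V k) (V-reach k ℕ.≤-refl)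

        choice : Σ (Fin n) λ u → Boundary G (V k) u ×
                 (∀ y → Boundary G (V k) y → β * d (vs k) u + f u ≤ β * d (vs k) y + f y)
        choice = minimiser (Boundary G (V k)) boundary? (λ u → β * d (vs k) u + f u)
                   (ExitToward.p (exitToward g g∉Vₖ) , exit-boundary (exitToward g g∉Vₖ))

        u* = proj₁ choice
        vs′ = vs [ suc k ≔ u* ]
        c′ = c [ suc k ≔ d (vs k) u* ]

        vsₖ∈Vₖ : V k (vs k)
        vsₖ∈Vₖ = k , ℕ.≤-refl , refl

        greedy-step : GreedyStep (V k) (vs k) u* (d (vs k) u*)
        greedy-step = u*∈∂V , isShortest-incident (vs k) u* vsₖ∈Vₖ u*∈∂V ,
          λ u du u∈∂V u-shortest →
            subst (λ t → β * d (vs k) u* + f u* ≤ β * t + f u)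
              (shortest-unique (isShortest-incident (vs k) u vsₖ∈Vₖ u∈∂V) u-shortest)
              (proj₂ (proj₂ choice) u u∈∂V)
          where
          u*∈∂V = proj₁ (proj₂ choice)

        vs′-old : ∀ i → i ≤ℕ k → vs′ i ≡ vs i
        vs′-old i i≤k = [≔]-≢ vs (ℕ.<⇒≢ (s≤s i≤k))

        c′-old : ∀ i → i ≤ℕ k → c′ i ≡ c i
        c′-old i i≤k = [≔]-≢ c (ℕ.<⇒≢ (s≤s i≤k))

      extension : Σ (ℕ → Fin n) λ vs′ → Σ (ℕ → ℚ) λ c′ →
                  (∀ i → i ≤ℕ k → vs′ i ≡ vs i) × (∀ i → i ≤ℕ k → c′ i ≡ c i) ×
                  ValidPrefix G β f r g (suc k) vs′ c′
      extension = vs′ , c′ , vs′-old , c′-old , trans (vs′-old 0 z≤n) (proj₁ run) , avoids-g , valid-steps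
        where
        avoids-g : ∀ j → j <ℕ suc k → vs′ j ≢ g
        avoids-g j j<1+k with ℕ.m≤n⇒m<n∨m≡n (s≤s⁻¹ j<1+k)
        ... | inj₁ j<k  = subst (_≢ g) (sym (vs′-old j (ℕ.<⇒≤ j<k))) (proj₁ (proj₂ run) j j<k)
        ... | inj₂ refl = subst (_≢ g) (sym (vs′-old j ℕ.≤-refl)) vsₖ≢g

        valid-steps : ∀ j → j <ℕ suc k → ValidStep G β f vs′ c′ j
        valid-steps j j<1+k with ℕ.m≤n⇒m<n∨m≡n (s≤s⁻¹ j<1+k)
        ... | inj₁ j<k  = ValidStep-agree {vs} {vs′} {c} {c′} j
                            (λ i i≤1+j → vs′-old i (ℕ.≤-trans i≤1+j j<k)) (c′-old (suc j) j<k)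
                            (proj₂ (proj₂ run) j j<k)
        ... | inj₂ refl = GreedyStep-resp
                            (Visited-agree j vs′-old) (Visited-agree j (λ i i≤j → sym (vs′-old i i≤j)))
                            (sym (vs′-old j ℕ.≤-refl)) (sym ([≔]-≡ vs {suc k} {u*}))
                            (sym ([≔]-≡ c {suc k} {d (vs k) u*}))
                            greedy-step

  progress : ∀ k vs c → ValidPrefix G β f r g k vs c → vs k ≢ g →
             Σ (ℕ → Fin n) λ vs′ → Σ (ℕ → ℚ) λ c′ →
             (∀ i → i ≤ℕ k → vs′ i ≡ vs i) × (∀ i → i ≤ℕ k → c′ i ≡ c i) ×
             ValidPrefix G β f r g (suc k) vs′ c′
  progress k vs c run = Prefix.extension run

module CompetitiveRatio {n : ℕ} (G : WGraph n) {d : Fin n → Fin n → ℚ} (isDist : IsDistG G d) (tree : IsTree G)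
  (f : Fin n → ℚ) (r g : Fin n) (ε : ℚ) (0≤ε : 0ℚ ≤ ε) (ε≤⅓ : ε ≤ + 1 / 3)
  (predictions : ∀ v → ((1ℚ - ε) * d v g ≤ f v) × (f v ≤ (1ℚ + ε) * d v g)) where
  open Distance G isDist
  open PredictionArithmetic ε 0≤ε ε≤⅓
  open Runs G isDist tree (+ 2 / 3) f r g

  module _ {k vs c} (run : ValidPrefix G (+ 2 / 3) f r g k vs c) where
    open Prefix {k} {vs} {c} run

    -- p is where the r–g path leaves V_j; the greedy rule could have chosen it.
    potential-increment : ∀ j → j <ℕ k →
      potential (costSum c (suc j)) (d (vs (suc j)) g) ≤ potential (costSum c j) (d (vs j) g) + δ (d r g)
    potential-increment j j<k =
      potential-step {S = costSum c j} {c = c (suc j)} {D = d v g}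
        (step-cost-bound {a = d v p} {b = d p g} {c = c (suc j)} comparison
          (exit-separates exit v (inj₁ v∈V)) (d-nonNeg v p))
        (step-distance-bound {a = d v p} {b = d p g} {c = c (suc j)} {e = d x p} comparison detour
          (exit-separates exit x (inj₂ x∈∂V)) p-closer)
      where
      open Region G isDist tree (V j) (visited? vs j) r (r∈V j) (V-reach j (ℕ.<⇒≤ j<k))
      exit = exitToward g (g∉V j j<k)
      p = ExitToward.p exit
      v = vs j
      x = vs (suc j)
      step-j = proj₂ (proj₂ run) j j<k
      x∈∂V = proj₁ step-j
      v∈V : V j v
      v∈V = j , ℕ.≤-refl , refl

      comparison : + 3 / 1 * (1ℚ - ε) * d x g + + 2 / 1 * c (suc j)
                 ≤ + 2 / 1 * d v p + + 3 / 1 * (1ℚ + ε) * d p g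
      comparison = greedy-comparison {d v p} {d p g} {c (suc j)}
        (proj₁ (predictions x)) (proj₂ (predictions p))
        (proj₂ (proj₂ step-j) p (d v p) (exit-boundary exit) (isShortest-incident v p v∈V (exit-boundary exit)))

      detour : d v p ≤ c (suc j) + d x p
      detour = ℚ.≤-trans (d-triangle v x p) (ℚ.+-monoˡ-≤ (d x p) (d≤isShortest (proj₁ (proj₂ step-j))))

      p-closer : d p g ≤ d r g
      p-closer = ℚ.≤-trans (p≤q+p (d-nonNeg r p)) (exit-separates exit r (inj₁ (r∈V j)))

    competitive : vs k ≡ g →
      costSum c k * (μ * μ) ≤ (+ 2 / 1 * (μ * μ) + 1ℚ * (ℕ→ℚ n * ε * (+ 5 / 1 + + 3 / 1 * ε))) * d r g
    competitive vsₖ≡g =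
      competitive-bound (d-nonNeg r g) (ℕ→ℚ-nonNeg k) (ℕ→ℚ-mono-≤ (ℕ.<⇒≤ length<n))
        (subst (λ D → potential (costSum c k) D ≤ potential 0ℚ (d r g) + ℕ→ℚ k * δ (d r g))
          (trans (cong (λ u → d u g) vsₖ≡g) (d-refl g))
          potential-bound)
      where
      potential-bound : potential (costSum c k) (d (vs k) g) ≤ potential 0ℚ (d r g) + ℕ→ℚ k * δ (d r g)
      potential-bound = ≤-telescope (λ j → potential (costSum c j) (d (vs j) g)) k
        (ℚ.≤-reflexive (cong (λ u → potential 0ℚ (d u g)) (proj₁ run))) potential-increment

theorem3 : Σ ℚ λ C →
    ∀ (n : ℕ) (G : WGraph n) → IsTree G →
    ∀ (d : Fin n → Fin n → ℚ) → IsDistG G d →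
    ∀ (r g : Fin n) → r ≢ g →
    ∀ (ε : ℚ) → 0ℚ < ε → ε < + 1 / 3 →
    ∀ (f : Fin n → ℚ) →
    (∀ v → ((1ℚ - ε) * d v g ≤ f v) × (f v ≤ (1ℚ + ε) * d v g)) →
    (∀ k vs c → ValidPrefix G (+ 2 / 3) f r g k vs c → vs k ≢ g →
       Σ (ℕ → Fin n) λ vs′ → Σ (ℕ → ℚ) λ c′ →
         (∀ i → i ≤ℕ k → vs′ i ≡ vs i) × (∀ i → i ≤ℕ k → c′ i ≡ c i) ×
         ValidPrefix G (+ 2 / 3) f r g (suc k) vs′ c′)
    ×
    (∀ k vs c → ValidPrefix G (+ 2 / 3) f r g k vs c → vs k ≡ g →
       costSum c k * ((1ℚ - + 3 / 1 * ε) * (1ℚ - + 3 / 1 * ε))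
         ≤ (+ 2 / 1 * ((1ℚ - + 3 / 1 * ε) * (1ℚ - + 3 / 1 * ε))
             + C * (ℕ→ℚ n * ε * (+ 5 / 1 + + 3 / 1 * ε))) * d r g)
theorem3 = 1ℚ , λ n G tree d isDist r g _ ε 0<ε ε<⅓ f predictions →
  Runs.progress G isDist tree (+ 2 / 3) f r g ,
  λ k vs c run →
    CompetitiveRatio.competitive G isDist tree f r g ε (ℚ.<⇒≤ 0<ε) (ℚ.<⇒≤ ε<⅓) predictions {k} {vs} {c} run
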